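{- For all positive integers $n$ and $r$, $$\sum_{k=0}^{n-1}(-1)^k(2k+1)^{2r-1}\equiv 0\pmod n.$$ -}

module Defs where

open import Data.Nat using (ℕ; zero; suc)
open import Data.Integer using (ℤ; +_; -_; _+_; _*_; _^_)

sumTo : ℕ → (ℕ → ℤ) → ℤ
sumTo zero    f = + 0
sumTo (suc n) f = sumTo n f + f n

signPow : ℕ → ℤ
signPow k = (- (+ 1)) ^ k

-- the summand (-1)^k (2k+1)^(2r-1); ∸ is truncated subtraction, exact since r ≥ 1
-- is assumed in the statement.
term : ℕ → ℕ → ℤ
term r k = signPow k * (+ (2 Data.Nat.* k Data.Nat.+ 1)) ^ (2 Data.Nat.* r Data.Nat.∸ 1)

-- Write S(n) for the sum, with odd exponent m = 2r - 1.
-- For odd n, the terms k and n - 1 - k carry the same sign and their bases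
-- 2k + 1 and 2(n - 1 - k) + 1 add up to 2n, which divides the sum of their
-- m-th powers; pairing S(n) with its reversal gives 2n ∣ 2 S(n).
-- For n = 2h, the shift k ↦ h + k changes the base by 2h and the sign by
-- (-1)^h, so S(2h) ≡ (1 + (-1)^h) S(h) mod 2h; as 1 + (-1)^h is even and
-- h ∣ S(h) by strong induction, 2h ∣ S(2h).

module Submission where

open import Defs
open import Data.Nat as ℕ using (ℕ; NonZero; zero; suc; _<_; _∸_; z<s)
import Data.Nat.Properties as ℕ
open import Data.Nat.Induction using (<-rec)
import Data.Nat.Tactic.RingSolver as ℕ-Solver
open import Data.Integer using (+_; -_; _+_; _-_; _*_; _^_; 1ℤ; -1ℤ)
open import Data.Integer.Properties
open import Data.Integer.Divisibility using (_∣_)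
open import Data.Integer.Divisibility.Signed
  using (divides; ∣-refl; ∣-reflexive; ∣-trans; ∣m∣n⇒∣m+n; ∣m∣n⇒∣m-n; ∣n⇒∣m*n; ∣m⇒∣m*n; *-monoʳ-∣; *-monoˡ-∣; *-cancelˡ-∣; ∣⇒∣ᵤ)
  renaming (_∣_ to _∣ₛ_)
open import Data.Integer.Tactic.RingSolver using (solve-∀)
open import Data.Product using (∃-syntax; _,_)
open import Data.Sum using (_⊎_; inj₁; inj₂)
open import Relation.Binary.PropositionalEquality
open ≡-Reasoning

signPow-+ : ∀ m n → signPow (m ℕ.+ n) ≡ signPow m * signPow n
signPow-+ = ^-distribˡ-+-* -1ℤ

signPow-even : ∀ h → signPow (2 ℕ.* h) ≡ 1ℤ
signPow-even h = trans (sym (^-*-assoc -1ℤ 2 h)) (^-zeroˡ h)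

signPow-+-even : ∀ m h → signPow (m ℕ.+ 2 ℕ.* h) ≡ signPow m
signPow-+-even m h = begin
  signPow (m ℕ.+ 2 ℕ.* h)      ≡⟨ signPow-+ m (2 ℕ.* h) ⟩
  signPow m * signPow (2 ℕ.* h) ≡⟨ cong (signPow m *_) (signPow-even h) ⟩
  signPow m * 1ℤ                ≡⟨ *-identityʳ (signPow m) ⟩
  signPow m                     ∎

signPow-complement : ∀ k j h → k ℕ.+ j ≡ 2 ℕ.* h → signPow j ≡ signPow k
signPow-complement k j h k+j≡2h = begin
  signPow j                ≡⟨ signPow-+-even j k ⟨
  signPow (j ℕ.+ 2 ℕ.* k)  ≡⟨ cong signPow j+2k≡k+2h ⟩
  signPow (k ℕ.+ 2 ℕ.* h)  ≡⟨ signPow-+-even k h ⟩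
  signPow k                ∎
  where
  regroup : ∀ j k → j ℕ.+ 2 ℕ.* k ≡ k ℕ.+ (k ℕ.+ j)
  regroup = ℕ-Solver.solve-∀
  j+2k≡k+2h : j ℕ.+ 2 ℕ.* k ≡ k ℕ.+ 2 ℕ.* h
  j+2k≡k+2h = trans (regroup j k) (cong (k ℕ.+_) k+j≡2h)

2∣1+signPow : ∀ n → + 2 ∣ₛ 1ℤ + signPow n
2∣1+signPow zero    = ∣-refl
2∣1+signPow (suc n) = subst (+ 2 ∣ₛ_) (flip-sign (signPow n)) (∣m∣n⇒∣m-n ∣-refl (2∣1+signPow n))
  where
  flip-sign : ∀ s → + 2 - (1ℤ + s) ≡ 1ℤ + -1ℤ * s
  flip-sign = solve-∀

∣x-y⇒∣xᵐ-yᵐ : ∀ {d} x y m → d ∣ₛ x - y → d ∣ₛ x ^ m - y ^ m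
∣x-y⇒∣xᵐ-yᵐ x y zero    d∣x-y = divides (+ 0) refl
∣x-y⇒∣xᵐ-yᵐ {d} x y (suc m) d∣x-y = subst (d ∣ₛ_) (sym (telescope x y (x ^ m) (y ^ m)))
  (∣m∣n⇒∣m+n (∣n⇒∣m*n x (∣x-y⇒∣xᵐ-yᵐ x y m d∣x-y)) (∣m⇒∣m*n (y ^ m) d∣x-y))
  where
  telescope : ∀ x y a b → x * a - y * b ≡ x * (a - b) + (x - y) * b
  telescope = solve-∀

-^-odd : ∀ x t → (- x) ^ suc (2 ℕ.* t) ≡ - (x ^ suc (2 ℕ.* t))
-^-odd x t = begin
  (- x) * (- x) ^ (2 ℕ.* t)    ≡⟨ cong ((- x) *_) (^-*-assoc (- x) 2 t) ⟨
  (- x) * ((- x) ^ 2) ^ t      ≡⟨ cong (λ y → (- x) * y ^ t) (neg-square x) ⟩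
  (- x) * (x ^ 2) ^ t          ≡⟨ cong ((- x) *_) (^-*-assoc x 2 t) ⟩
  (- x) * x ^ (2 ℕ.* t)        ≡⟨ neg-distribˡ-* x _ ⟨
  - (x * x ^ (2 ℕ.* t))        ∎
  where
  neg-square : ∀ x → (- x) * ((- x) * 1ℤ) ≡ x * (x * 1ℤ)
  neg-square = solve-∀

x+y∣xᵐ+yᵐ : ∀ x y t → x + y ∣ₛ x ^ suc (2 ℕ.* t) + y ^ suc (2 ℕ.* t)
x+y∣xᵐ+yᵐ x y t = subst₂ _∣ₛ_ (cong (λ z → x + z) (neg-involutive y)) (cong (λ z → x ^ m + z) -[-y]ᵐ≡yᵐ)
  (∣x-y⇒∣xᵐ-yᵐ x (- y) m ∣-refl)
  where
  m = suc (2 ℕ.* t)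
  -[-y]ᵐ≡yᵐ : - ((- y) ^ m) ≡ y ^ m
  -[-y]ᵐ≡yᵐ = trans (cong -_ (-^-odd y t)) (neg-involutive (y ^ m))

sumTo-+ : ∀ n f g → sumTo n (λ k → f k + g k) ≡ sumTo n f + sumTo n g
sumTo-+ zero    f g = refl
sumTo-+ (suc n) f g =
  trans (cong (_+ (f n + g n)) (sumTo-+ n f g)) (interchange (sumTo n f) (sumTo n g) (f n) (g n))
  where
  interchange : ∀ a b c d → (a + b) + (c + d) ≡ (a + c) + (b + d)
  interchange = solve-∀

sumTo-* : ∀ n c f → sumTo n (λ k → c * f k) ≡ c * sumTo n f
sumTo-* zero    c f = sym (*-zeroʳ c)
sumTo-* (suc n) c f = trans (cong (_+ c * f n) (sumTo-* n c f)) (sym (*-distribˡ-+ c (sumTo n f) (f n)))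

sumTo-split : ∀ m n f → sumTo (m ℕ.+ n) f ≡ sumTo m f + sumTo n (λ k → f (m ℕ.+ k))
sumTo-split m zero    f = trans (cong (λ i → sumTo i f) (ℕ.+-identityʳ m)) (sym (+-identityʳ (sumTo m f)))
sumTo-split m (suc n) f = begin
  sumTo (m ℕ.+ suc n) f                                   ≡⟨ cong (λ i → sumTo i f) (ℕ.+-suc m n) ⟩
  sumTo (m ℕ.+ n) f + f (m ℕ.+ n)                         ≡⟨ cong (_+ f (m ℕ.+ n)) (sumTo-split m n f) ⟩
  sumTo m f + sumTo n (λ k → f (m ℕ.+ k)) + f (m ℕ.+ n)   ≡⟨ +-assoc (sumTo m f) _ _ ⟩
  sumTo m f + sumTo (suc n) (λ k → f (m ℕ.+ k))           ∎

sumTo-head : ∀ n f → sumTo (suc n) f ≡ f 0 + sumTo n (λ k → f (suc k))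
sumTo-head n f = trans (sumTo-split 1 n f) (cong (_+ sumTo n (λ k → f (suc k))) (+-identityˡ (f 0)))

sumTo-reverse : ∀ n f → sumTo n f ≡ sumTo n (λ k → f (n ∸ suc k))
sumTo-reverse zero    f = refl
sumTo-reverse (suc n) f = begin
  sumTo n f + f n                                 ≡⟨ +-comm (sumTo n f) (f n) ⟩
  f n + sumTo n f                                 ≡⟨ cong (λ s → f n + s) (sumTo-reverse n f) ⟩
  f n + sumTo n (λ k → f (n ∸ suc k))             ≡⟨ sumTo-head n (λ k → f (suc n ∸ suc k)) ⟨
  sumTo (suc n) (λ k → f (suc n ∸ suc k))         ∎

∣-sumTo : ∀ {d} n f → (∀ k → k < n → d ∣ₛ f k) → d ∣ₛ sumTo n f
∣-sumTo zero    f d∣f = divides (+ 0) refl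
∣-sumTo (suc n) f d∣f = ∣m∣n⇒∣m+n (∣-sumTo n f (λ k k<n → d∣f k (ℕ.m<n⇒m<1+n k<n))) (d∣f n ℕ.≤-refl)

∣-sumTo-cong : ∀ {d} n f g → (∀ k → k < n → d ∣ₛ f k - g k) → d ∣ₛ sumTo n f - sumTo n g
∣-sumTo-cong zero    f g d∣f-g = divides (+ 0) refl
∣-sumTo-cong {d} (suc n) f g d∣f-g =
  subst (d ∣ₛ_) (sym (interchange (sumTo n f) (f n) (sumTo n g) (g n)))
  (∣m∣n⇒∣m+n (∣-sumTo-cong n f g (λ k k<n → d∣f-g k (ℕ.m<n⇒m<1+n k<n))) (d∣f-g n ℕ.≤-refl))
  where
  interchange : ∀ a b c e → (a + b) - (c + e) ≡ (a - c) + (b - e)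
  interchange = solve-∀

∣-sumTo-double : ∀ h f → (∀ k → k < h → + (2 ℕ.* h) ∣ₛ f (h ℕ.+ k) - signPow h * f k) →
                 + h ∣ₛ sumTo h f → + (2 ℕ.* h) ∣ₛ sumTo (2 ℕ.* h) f
∣-sumTo-double h f shift h∣S = subst (+ (2 ℕ.* h) ∣ₛ_) (sym S₂≡) (∣m∣n⇒∣m+n 2h∣T-sS 2h∣[1+s]S)
  where
  S = sumTo h f
  T = sumTo h (λ k → f (h ℕ.+ k))
  s = signPow h
  2h∣T-sS : + (2 ℕ.* h) ∣ₛ T - s * S
  2h∣T-sS = subst (λ z → + (2 ℕ.* h) ∣ₛ T - z) (sumTo-* h s f) (∣-sumTo-cong h _ _ shift)
  2h∣[1+s]S : + (2 ℕ.* h) ∣ₛ (1ℤ + s) * S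
  2h∣[1+s]S = subst (_∣ₛ (1ℤ + s) * S) (sym (pos-* 2 h))
    (∣-trans (*-monoʳ-∣ (+ 2) h∣S) (*-monoˡ-∣ S (2∣1+signPow h)))
  rearrange : ∀ s S T → S + T ≡ (T - s * S) + (1ℤ + s) * S
  rearrange = solve-∀
  S₂≡ : sumTo (2 ℕ.* h) f ≡ (T - s * S) + (1ℤ + s) * S
  S₂≡ = begin
    sumTo (2 ℕ.* h) f   ≡⟨ cong (λ i → sumTo (h ℕ.+ i) f) (ℕ.+-identityʳ h) ⟩
    sumTo (h ℕ.+ h) f   ≡⟨ sumTo-split h h f ⟩
    S + T               ≡⟨ rearrange s S T ⟩
    (T - s * S) + (1ℤ + s) * S ∎

∣-sumTo-paired : ∀ {d} n f → (∀ k → k < n → d ∣ₛ f k + f (n ∸ suc k)) → d ∣ₛ sumTo n f + sumTo n f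
∣-sumTo-paired {d} n f pair = subst (d ∣ₛ_) S+S≡ (∣-sumTo n _ pair)
  where
  S+S≡ : sumTo n (λ k → f k + f (n ∸ suc k)) ≡ sumTo n f + sumTo n f
  S+S≡ = trans (sumTo-+ n f _) (cong (λ z → sumTo n f + z) (sym (sumTo-reverse n f)))

term-shift : ∀ r h k → + (2 ℕ.* h) ∣ₛ term r (h ℕ.+ k) - signPow h * term r k
term-shift r h k = subst (+ (2 ℕ.* h) ∣ₛ_) (sym difference≡)
  (∣n⇒∣m*n (signPow h * signPow k) (∣x-y⇒∣xᵐ-yᵐ A B m (∣-reflexive (sym A-B≡2h))))
  where
  m = 2 ℕ.* r ∸ 1
  A = + (2 ℕ.* (h ℕ.+ k) ℕ.+ 1)
  B = + (2 ℕ.* k ℕ.+ 1)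
  shifted : ∀ h k → 2 ℕ.* (h ℕ.+ k) ℕ.+ 1 ≡ 2 ℕ.* h ℕ.+ (2 ℕ.* k ℕ.+ 1)
  shifted = ℕ-Solver.solve-∀
  cancel : ∀ a b → (a + b) - b ≡ a
  cancel = solve-∀
  A-B≡2h : A - B ≡ + (2 ℕ.* h)
  A-B≡2h = begin
    A - B                       ≡⟨ cong (λ a → a - B) (trans (cong +_ (shifted h k)) (pos-+ (2 ℕ.* h) _)) ⟩
    (+ (2 ℕ.* h) + B) - B       ≡⟨ cancel (+ (2 ℕ.* h)) B ⟩
    + (2 ℕ.* h)                 ∎
  factor : ∀ s t a b → (s * t) * a - s * (t * b) ≡ (s * t) * (a - b)
  factor = solve-∀
  difference≡ : term r (h ℕ.+ k) - signPow h * term r k ≡ (signPow h * signPow k) * (A ^ m - B ^ m)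
  difference≡ = begin
    signPow (h ℕ.+ k) * A ^ m - signPow h * (signPow k * B ^ m)
      ≡⟨ cong (λ σ → σ * A ^ m - signPow h * (signPow k * B ^ m)) (signPow-+ h k) ⟩
    (signPow h * signPow k) * A ^ m - signPow h * (signPow k * B ^ m)
      ≡⟨ factor (signPow h) (signPow k) (A ^ m) (B ^ m) ⟩
    (signPow h * signPow k) * (A ^ m - B ^ m) ∎

odd-exponent : ∀ t → 2 ℕ.* suc t ∸ 1 ≡ suc (2 ℕ.* t)
odd-exponent t = cong (_∸ 1) (ℕ.*-suc 2 t)

term-reflect : ∀ t k j h → k ℕ.+ j ≡ 2 ℕ.* h → + (2 ℕ.* suc (2 ℕ.* h)) ∣ₛ term (suc t) k + term (suc t) j
term-reflect t k j h k+j≡2h = subst (+ (2 ℕ.* suc (2 ℕ.* h)) ∣ₛ_) (sym sum≡)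
  (∣n⇒∣m*n (signPow k) (∣-trans (∣-reflexive (sym A+B≡)) A+B∣Aᵐ+Bᵐ))
  where
  m = 2 ℕ.* suc t ∸ 1
  A = + (2 ℕ.* k ℕ.+ 1)
  B = + (2 ℕ.* j ℕ.+ 1)
  paired : ∀ k j → (2 ℕ.* k ℕ.+ 1) ℕ.+ (2 ℕ.* j ℕ.+ 1) ≡ 2 ℕ.* suc (k ℕ.+ j)
  paired = ℕ-Solver.solve-∀
  A+B≡ : A + B ≡ + (2 ℕ.* suc (2 ℕ.* h))
  A+B≡ = begin
    A + B                                       ≡⟨ pos-+ (2 ℕ.* k ℕ.+ 1) _ ⟨
    + ((2 ℕ.* k ℕ.+ 1) ℕ.+ (2 ℕ.* j ℕ.+ 1))     ≡⟨ cong +_ (paired k j) ⟩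
    + (2 ℕ.* suc (k ℕ.+ j))                     ≡⟨ cong (λ i → + (2 ℕ.* suc i)) k+j≡2h ⟩
    + (2 ℕ.* suc (2 ℕ.* h))                     ∎
  A+B∣Aᵐ+Bᵐ : A + B ∣ₛ A ^ m + B ^ m
  A+B∣Aᵐ+Bᵐ = subst (λ e → A + B ∣ₛ A ^ e + B ^ e) (sym (odd-exponent t)) (x+y∣xᵐ+yᵐ A B t)
  sum≡ : term (suc t) k + term (suc t) j ≡ signPow k * (A ^ m + B ^ m)
  sum≡ = begin
    signPow k * A ^ m + signPow j * B ^ m
      ≡⟨ cong (λ σ → signPow k * A ^ m + σ * B ^ m) (signPow-complement k j h k+j≡2h) ⟩
    signPow k * A ^ m + signPow k * B ^ m
      ≡⟨ *-distribˡ-+ (signPow k) (A ^ m) (B ^ m) ⟨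
    signPow k * (A ^ m + B ^ m) ∎

parity-split : ∀ n → ∃[ h ] (n ≡ 2 ℕ.* h ⊎ n ≡ suc (2 ℕ.* h))
parity-split zero = 0 , inj₁ refl
parity-split (suc n) with parity-split n
... | h , inj₁ refl = h , inj₂ refl
... | h , inj₂ refl = suc h , inj₁ (cong suc (sym (ℕ.+-suc h (h ℕ.+ 0))))

n∣sumTo-term : ∀ t n → + n ∣ₛ sumTo n (term (suc t))
n∣sumTo-term t = <-rec _ step
  where
  F = term (suc t)
  step : ∀ n → (∀ {m} → m < n → + m ∣ₛ sumTo m F) → + n ∣ₛ sumTo n F
  step n rec with parity-split n
  ... | zero    , inj₁ refl = ∣-refl
  ... | h@(suc _) , inj₁ refl =
    ∣-sumTo-double h F (λ k _ → term-shift (suc t) h k) (rec (ℕ.m<m+n h z<s))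
  ... | h , inj₂ refl = *-cancelˡ-∣ (+ 2) (subst₂ _∣ₛ_ (pos-* 2 n) (double (sumTo n F))
    (∣-sumTo-paired n F (λ k k<n → term-reflect t k _ h (ℕ.m+[n∸m]≡n (ℕ.s≤s⁻¹ k<n)))))
    where
    double : ∀ S → S + S ≡ + 2 * S
    double = solve-∀

lemma3p1 : (n r : ℕ) → .{{NonZero n}} → .{{NonZero r}} → (+ n) ∣ sumTo n (term r)
lemma3p1 n (suc t) = ∣⇒∣ᵤ (n∣sumTo-term t n)
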